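{- Let $f(x)=\sum_{i=0}^t b_i x^i\in\mathbb{F}_q[x]$ be monic of degree $t$ with $b_0\neq 0$, and let $\beta\in\mathbb{F}_q$ with $f(\beta)\neq 0$. Let $\mathbf{r}^{(0)}\in G(f)$ have a run of zeroes of length $l\ge 0$ starting at index $0$, and define $\mathbf{r}^{(i)}=(L-\beta)^{ -1}\mathbf{r}^{(i-1)}$ for $i\ge 1$. Let $z$ be the multiplicity of $\beta$ as a root of the polynomial $$P_{l,\mathbf{r}^{(0)}}(x)=\sum_{j=l+1}^{t} b_j\Big(\sum_{m=l}^{j-1}\mathbf{r}^{(0)}_m x^{j-1-m}\Big).$$ Then for every $0\le i\le z$, the stream $\mathbf{r}^{(i)}$ has a run of zeroes of length $l+i$ starting at index $0$, and $\mathbf{r}^{(z+1)}$ is not $0$ at index $0$.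
   Context: $G(f)$ is the set of sequences $(\mathbf{s}_n)_{n\in\mathbb{Z}}$ over $\mathbb{F}_q$ with $\sum_{i=0}^t b_i\mathbf{s}_{n+i}=0$ for all $n\in\mathbb{Z}$. $L$ is the left shift, $(L\mathbf{s})_n=\mathbf{s}_{n+1}$, and $(L-\beta)\mathbf{s}$ is the stream $(\mathbf{s}_{n+1}-\beta\mathbf{s}_n)_n$. Since $\gcd(x-\beta,f)=1$ there is $g\in\mathbb{F}_q[x]$ with $g(x)(x-\beta)\equiv1\pmod f$, and $(L-\beta)^{ -1}:=g(L)$ is the inverse of $L-\beta$ on $G(f)$. A stream $\mathbf{r}$ has a run of zeroes of length $l$ at index $n$ if $\mathbf{r}_{n-1}\neq0$, $\mathbf{r}_n=\cdots=\mathbf{r}_{n+l-1}=0$, and $\mathbf{r}_{n+l}\neq 0$. -}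

module Defs where

open import Level using (0ℓ)
open import Algebra.Bundles using (CommutativeRing)
open import Data.Nat using (ℕ; zero; suc; _∸_; _<_; _≤_)
open import Data.Integer using (ℤ; +_; -[1+_]) renaming (_+_ to _+ℤ_)
open import Data.Fin using (Fin)
open import Data.List using (List; []; _∷_; replicate; _++_)
open import Data.Product using (Σ; ∃; _×_; _,_)
open import Relation.Nullary using (¬_; Dec)

record FiniteField : Set₁ where
  field
    cring     : CommutativeRing 0ℓ 0ℓ
  open CommutativeRing cring public
  field
    1≉0       : ¬ (1# ≈ 0#)
    inverse   : ∀ x → ¬ (x ≈ 0#) → Σ Carrier (λ y → x * y ≈ 1#)
    _≟_       : ∀ x y → Dec (x ≈ y)
    size      : ℕ
    enum      : Fin size → Carrier
    enum-surj : ∀ x → Σ (Fin size) (λ i → enum i ≈ x)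

module _ (F : FiniteField) where
  open FiniteField F

  El : Set
  El = Carrier

  EqF : Carrier → Carrier → Set
  EqF x y = x ≈ y

  IsZero : Carrier → Set
  IsZero x = x ≈ 0#

  IsOne : Carrier → Set
  IsOne x = x ≈ 1#

  Stream : Set
  Stream = ℤ → Carrier

  sumFrom : ℕ → ℕ → (ℕ → Carrier) → Carrier
  sumFrom a zero    g = 0#
  sumFrom a (suc k) g = g a + sumFrom (suc a) k g

  -- ∑_{i=a}^{b} g i   (empty if b < a)
  sumRange : ℕ → ℕ → (ℕ → Carrier) → Carrier
  sumRange a b g = sumFrom a (suc b ∸ a) g

  -- Polynomials: coefficient lists, lowest degree first.
  Poly : Set
  Poly = List Carrier

  coeff : Poly → ℕ → Carrier
  coeff []       n       = 0#
  coeff (c ∷ cs) zero    = c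
  coeff (c ∷ cs) (suc n) = coeff cs n

  -- Coefficientwise equality of polynomials (trailing zeros ignored).
  _≈P_ : Poly → Poly → Set
  p ≈P p' = ∀ n → coeff p n ≈ coeff p' n

  eval : Poly → Carrier → Carrier
  eval []       x = 0#
  eval (c ∷ cs) x = c + x * eval cs x

  _+P_ : Poly → Poly → Poly
  []       +P q        = q
  (c ∷ cs) +P []       = c ∷ cs
  (c ∷ cs) +P (d ∷ ds) = (c + d) ∷ (cs +P ds)

  scaleP : Carrier → Poly → Poly
  scaleP a []       = []
  scaleP a (c ∷ cs) = (a * c) ∷ scaleP a cs

  monomial : ℕ → Carrier → Poly
  monomial k c = replicate k 0# ++ (c ∷ [])

  sumFromP : ℕ → ℕ → (ℕ → Poly) → Poly
  sumFromP a zero    g = []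
  sumFromP a (suc k) g = g a +P sumFromP (suc a) k g

  sumRangeP : ℕ → ℕ → (ℕ → Poly) → Poly
  sumRangeP a b g = sumFromP a (suc b ∸ a) g

  mulLin : Carrier → Poly → Poly
  mulLin β p = (0# ∷ p) +P scaleP (- β) p

  mulLinPow : Carrier → ℕ → Poly → Poly
  mulLinPow β zero    p = p
  mulLinPow β (suc k) p = mulLin β (mulLinPow β k p)

  Multiplicity : Carrier → Poly → ℕ → Set
  Multiplicity β P z = Σ Poly (λ Q → (P ≈P mulLinPow β z Q) × ¬ (eval Q β ≈ 0#))

  _^F_ : Carrier → ℕ → Carrier
  x ^F zero  = 1#
  x ^F suc k = x * (x ^F k)

  evalCoeffs : ℕ → (ℕ → Carrier) → Carrier → Carrier
  evalCoeffs t b x = sumRange 0 t (λ i → b i * (x ^F i))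

  InG : ℕ → (ℕ → Carrier) → Stream → Set
  InG t b s = ∀ (n : ℤ) → sumRange 0 t (λ i → b i * s (n +ℤ + i)) ≈ 0#

  shiftMinus : Carrier → Stream → Stream
  shiftMinus β s n = s (n +ℤ + 1) - β * s n

  RunOfZeroesAt0 : Stream → ℕ → Set
  RunOfZeroesAt0 r l =
    ¬ (r -[1+ 0 ] ≈ 0#) × (∀ m → m < l → r (+ m) ≈ 0#) × ¬ (r (+ l) ≈ 0#)

  Ppoly : ℕ → (ℕ → Carrier) → ℕ → Stream → Poly
  Ppoly t b l r =
    sumRangeP (suc l) t (λ j →
      scaleP (b j) (sumRangeP l (j ∸ 1) (λ m → monomial (j ∸ 1 ∸ m) (r (+ m)))))

module Submission where

-- Let s be a lift of r, i.e. (L - β) s = r, where r has a run of zeroes of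
-- length L at index 0.  Writing r m = s (m+1) - β s m, each inner sum
-- ∑_{m=L}^{j-1} r m x^(j-1-m) of P_{L,r} telescopes to
--     s j  -  β s L x^(j-1-L)  +  (x - β) ∑_{m=L+1}^{j-1} s m x^(j-1-m).
-- Two consequences drive the proof.
--   * Evaluating at β (where s m = β^m s 0 for m ≤ L) gives P_{L,r}(β) = -f(β) s 0,
--     so s 0 = 0 exactly when β is a root of P_{L,r}, as f(β) ≠ 0.
--   * If s 0 = 0, then s vanishes on [0, L], has a run of length L+1, and
--     P_{L,r} = (x - β) P_{L+1,s}.
-- Hence, as long as P_{L,r} = (x - β)^(k+1) Q, one step of (L - β)^(-1) lengthens
-- the run by one and cancels one factor x - β; once P_{L,r} = Q with Q(β) ≠ 0,
-- the next stream is nonzero at 0.  Iterating this z times gives the lemma.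

open import Defs
open import Data.Nat as ℕ using (ℕ; zero; suc; z≤n; s≤s; _≤_; _<_; _∸_)
import Data.Nat.Properties as ℕP
open import Data.Integer as ℤ using (ℤ; +_; -[1+_]; _⊖_)
import Data.Integer.Properties as ℤP
open import Data.Maybe using (Maybe; just; nothing)
open import Relation.Nullary using (¬_; yes; no)
open import Data.Product using (_,_; _×_; proj₁; proj₂)
open import Relation.Binary.PropositionalEquality as ≡ using (_≡_)
import Algebra.Solver.Ring.AlmostCommutativeRing as ACR
open import Data.List using ([]; _∷_; length)

module RunsOfZeroes (F : FiniteField) where
  open FiniteField F hiding (zero)
  open import Algebra.Properties.Ring ring using (-0#≈0#; -‿involutive; -‿+-comm; -‿distribˡ-*; xyx⁻¹≈y)
  open import Algebra.Properties.Monoid.Mult +-monoid using (×-homo-+) renaming (_×_ to _·_)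
  open import Relation.Binary.Reasoning.Setoid setoid

  -- The canonical ring homomorphism ℤ → F, needed to run the ring solver with
  -- integer coefficients: F has no computable zero test, so only integer
  -- coefficients let the solver cancel terms such as x - x.
  ⟦_⟧ℤ : ℤ → Carrier
  ⟦ + n ⟧ℤ      = n · 1#
  ⟦ -[1+ n ] ⟧ℤ = - (suc n · 1#)

  -- ⟦_⟧ℤ is additive on differences of naturals; this covers every sign case of ℤ.+.
  ⊖-homo : ∀ m n → ⟦ m ⊖ n ⟧ℤ ≈ m · 1# - n · 1#
  ⊖-homo m zero = begin
    ⟦ m ⊖ 0 ⟧ℤ  ≡⟨ ≡.cong ⟦_⟧ℤ (ℤP.⊖-≥ {m} {0} z≤n) ⟩
    m · 1#      ≈⟨ +-identityʳ _ ⟨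
    m · 1# + 0# ≈⟨ +-congˡ -0#≈0# ⟨
    m · 1# - 0# ∎
  ⊖-homo zero (suc n) = begin
    ⟦ 0 ⊖ suc n ⟧ℤ       ≡⟨ ≡.cong ⟦_⟧ℤ (ℤP.⊖-≤ {0} {suc n} z≤n) ⟩
    - (suc n · 1#)       ≈⟨ +-identityˡ _ ⟨
    0# - (suc n · 1#)    ∎
  ⊖-homo (suc m) (suc n) = begin
    ⟦ suc m ⊖ suc n ⟧ℤ             ≡⟨ ≡.cong ⟦_⟧ℤ (ℤP.[1+m]⊖[1+n]≡m⊖n m n) ⟩
    ⟦ m ⊖ n ⟧ℤ                     ≈⟨ ⊖-homo m n ⟩
    m · 1# - n · 1#                   ≈⟨ +-congʳ (xyx⁻¹≈y 1# _) ⟨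
    (1# + m · 1#) - 1# - n · 1#       ≈⟨ +-assoc _ _ _ ⟩
    (1# + m · 1#) + (- 1# - n · 1#)   ≈⟨ +-congˡ (-‿+-comm 1# _) ⟩
    (1# + m · 1#) - (1# + n · 1#)     ∎

  ℤ-+-homo : ∀ i j → ⟦ i ℤ.+ j ⟧ℤ ≈ ⟦ i ⟧ℤ + ⟦ j ⟧ℤ
  ℤ-+-homo (+ m)      (+ n)      = ×-homo-+ 1# m n
  ℤ-+-homo (+ m)      -[1+ n ]   = ⊖-homo m (suc n)
  ℤ-+-homo -[1+ m ]   (+ n)      = trans (⊖-homo n (suc m)) (+-comm _ _)
  ℤ-+-homo -[1+ m ]   -[1+ n ]   = begin
    - (suc (suc (m ℕ.+ n)) · 1#)          ≡⟨ ≡.cong (λ k → - (suc k · 1#)) (ℕP.+-suc m n) ⟨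
    - ((suc m ℕ.+ suc n) · 1#)            ≈⟨ -‿cong (×-homo-+ 1# (suc m) (suc n)) ⟩
    - (suc m · 1# + suc n · 1#)           ≈⟨ -‿+-comm _ _ ⟨
    - (suc m · 1#) + - (suc n · 1#)       ∎

  ℤ-neg-homo : ∀ i → ⟦ ℤ.- i ⟧ℤ ≈ - ⟦ i ⟧ℤ
  ℤ-neg-homo (+ zero)  = sym -0#≈0#
  ℤ-neg-homo (+ suc n) = refl
  ℤ-neg-homo -[1+ n ]  = sym (-‿involutive _)

  ℕ-*-homo : ∀ m j → ⟦ + m ℤ.* j ⟧ℤ ≈ m · 1# * ⟦ j ⟧ℤ
  ℕ-*-homo zero    j = sym (zeroˡ _)
  ℕ-*-homo (suc m) j = begin
    ⟦ + suc m ℤ.* j ⟧ℤ              ≡⟨ ≡.cong ⟦_⟧ℤ (ℤP.suc-* (+ m) j) ⟩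
    ⟦ j ℤ.+ + m ℤ.* j ⟧ℤ            ≈⟨ ℤ-+-homo j (+ m ℤ.* j) ⟩
    ⟦ j ⟧ℤ + ⟦ + m ℤ.* j ⟧ℤ          ≈⟨ +-cong (sym (*-identityˡ _)) (ℕ-*-homo m j) ⟩
    1# * ⟦ j ⟧ℤ + m · 1# * ⟦ j ⟧ℤ    ≈⟨ distribʳ _ _ _ ⟨
    (1# + m · 1#) * ⟦ j ⟧ℤ           ∎

  ℤ-*-homo : ∀ i j → ⟦ i ℤ.* j ⟧ℤ ≈ ⟦ i ⟧ℤ * ⟦ j ⟧ℤ
  ℤ-*-homo (+ m)    j = ℕ-*-homo m j
  ℤ-*-homo -[1+ m ] j = begin
    ⟦ -[1+ m ] ℤ.* j ⟧ℤ             ≡⟨ ≡.cong ⟦_⟧ℤ (ℤP.neg-distribˡ-* (+ suc m) j) ⟨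
    ⟦ ℤ.- (+ suc m ℤ.* j) ⟧ℤ        ≈⟨ ℤ-neg-homo (+ suc m ℤ.* j) ⟩
    - ⟦ + suc m ℤ.* j ⟧ℤ            ≈⟨ -‿cong (ℕ-*-homo (suc m) j) ⟩
    - (suc m · 1# * ⟦ j ⟧ℤ)         ≈⟨ -‿distribˡ-* _ _ ⟩
    - (suc m · 1#) * ⟦ j ⟧ℤ         ∎

  ℤ-homomorphism : ℤ.+-*-rawRing ACR.-Raw-AlmostCommutative⟶ ACR.fromCommutativeRing cring
  ℤ-homomorphism = record
    { ⟦_⟧ = ⟦_⟧ℤ ; +-homo = ℤ-+-homo ; *-homo = ℤ-*-homo ; -‿homo = ℤ-neg-homo
    ; 0-homo = refl ; 1-homo = +-identityʳ 1# }

  ℤ-coefficient-test : ∀ i j → Maybe (⟦ i ⟧ℤ ≈ ⟦ j ⟧ℤ)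
  ℤ-coefficient-test i j with i ℤ.≟ j
  ... | yes ≡.refl = just refl
  ... | no _       = nothing

  open import Algebra.Solver.Ring ℤ.+-*-rawRing (ACR.fromCommutativeRing cring) ℤ-homomorphism ℤ-coefficient-test
    using (solve; _:+_; _:*_; :-_; _:-_; _:=_; con)

  nonzero-cancel : ∀ {a x} → ¬ (a ≈ 0#) → a * x ≈ 0# → x ≈ 0#
  nonzero-cancel {a} {x} a≉0 ax≈0 with inverse a a≉0
  ... | a⁻¹ , aa⁻¹≈1 = begin
    x                ≈⟨ *-identityˡ x ⟨
    1# * x           ≈⟨ *-congʳ aa⁻¹≈1 ⟨
    (a * a⁻¹) * x    ≈⟨ solve 3 (λ a a⁻¹ x → (a :* a⁻¹) :* x := a⁻¹ :* (a :* x)) refl a a⁻¹ x ⟩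
    a⁻¹ * (a * x)    ≈⟨ *-congˡ ax≈0 ⟩
    a⁻¹ * 0#         ≈⟨ zeroʳ a⁻¹ ⟩
    0#               ∎

  _^_ : Carrier → ℕ → Carrier
  _^_ = _^F_ F

  ^-+ : ∀ x m n → x ^ (m ℕ.+ n) ≈ x ^ m * x ^ n
  ^-+ x zero    n = sym (*-identityˡ _)
  ^-+ x (suc m) n = trans (*-congˡ (^-+ x m n)) (sym (*-assoc _ _ _))

  ∑ : ℕ → ℕ → (ℕ → Carrier) → Carrier
  ∑ = sumFrom F

  ∑-cong : ∀ a k {f g} → (∀ m → a ≤ m → f m ≈ g m) → ∑ a k f ≈ ∑ a k g
  ∑-cong a zero    f≈g = refl
  ∑-cong a (suc k) f≈g = +-cong (f≈g a ℕP.≤-refl) (∑-cong (suc a) k (λ m a<m → f≈g m (ℕP.<⇒≤ a<m)))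

  ∑-+ : ∀ a k f g → ∑ a k (λ m → f m + g m) ≈ ∑ a k f + ∑ a k g
  ∑-+ a zero    f g = sym (+-identityʳ _)
  ∑-+ a (suc k) f g = begin
    (f a + g a) + ∑ (suc a) k (λ m → f m + g m)       ≈⟨ +-congˡ (∑-+ (suc a) k f g) ⟩
    (f a + g a) + (∑ (suc a) k f + ∑ (suc a) k g)     ≈⟨ solve 4 (λ x y X Y → (x :+ y) :+ (X :+ Y) := (x :+ X) :+ (y :+ Y)) refl _ _ _ _ ⟩
    (f a + ∑ (suc a) k f) + (g a + ∑ (suc a) k g)     ∎

  ∑-scale : ∀ a k c f → ∑ a k (λ m → c * f m) ≈ c * ∑ a k f
  ∑-scale a zero    c f = sym (zeroʳ c)
  ∑-scale a (suc k) c f = trans (+-congˡ (∑-scale (suc a) k c f)) (sym (distribˡ _ _ _))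

  ∑-skip-zeros : ∀ d a k f → (∀ m → m < d ℕ.+ a → f m ≈ 0#) → ∑ a k f ≈ ∑ (d ℕ.+ a) (k ∸ d) f
  ∑-skip-zeros zero    a k       f zeros = refl
  ∑-skip-zeros (suc d) a zero    f zeros = refl
  ∑-skip-zeros (suc d) a (suc k) f zeros = begin
    f a + ∑ (suc a) k f                  ≈⟨ +-cong (zeros a (s≤s (ℕP.m≤n+m a d))) (∑-skip-zeros d (suc a) k f zeros′) ⟩
    0# + ∑ (d ℕ.+ suc a) (k ∸ d) f       ≈⟨ +-identityˡ _ ⟩
    ∑ (d ℕ.+ suc a) (k ∸ d) f            ≡⟨ ≡.cong (λ i → ∑ i (k ∸ d) f) (ℕP.+-suc d a) ⟩
    ∑ (suc d ℕ.+ a) (k ∸ d) f            ∎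
    where
    zeros′ : ∀ m → m < d ℕ.+ suc a → f m ≈ 0#
    zeros′ m m<d+1+a = zeros m (ℕP.<-≤-trans m<d+1+a (ℕP.≤-reflexive (ℕP.+-suc d a)))

  ∑-tail : ∀ t L h → (∀ m → m ≤ L → h m ≈ 0#) → ∑ 0 (suc t) h ≈ ∑ (suc L) (t ∸ L) h
  ∑-tail t L h zeros = begin
    ∑ 0 (suc t) h                   ≈⟨ ∑-skip-zeros (suc L) 0 (suc t) h (λ m m<L+1 → zeros m (ℕP.≤-pred (ℕP.<-≤-trans m<L+1 (ℕP.≤-reflexive (ℕP.+-identityʳ (suc L)))))) ⟩
    ∑ (suc L ℕ.+ 0) (t ∸ L) h       ≡⟨ ≡.cong (λ i → ∑ i (t ∸ L) h) (ℕP.+-identityʳ (suc L)) ⟩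
    ∑ (suc L) (t ∸ L) h             ∎

  ∑-drop-first : ∀ a k f → f a ≈ 0# → ∑ a k f ≈ ∑ (suc a) (ℕ.pred k) f
  ∑-drop-first a zero    f fa≈0 = refl
  ∑-drop-first a (suc k) f fa≈0 = trans (+-congʳ fa≈0) (+-identityˡ _)

  Pol : Set
  Pol = Poly F

  cf : Pol → ℕ → Carrier
  cf = coeff F

  ev : Pol → Carrier → Carrier
  ev = eval F

  infixl 6 _⊕_
  _⊕_ : Pol → Pol → Pol
  _⊕_ = _+P_ F

  infix 4 _≋_
  _≋_ : Pol → Pol → Set
  _≋_ = _≈P_ F

  ×lin : Carrier → Pol → Pol
  ×lin = mulLin F

  ∑P : ℕ → ℕ → (ℕ → Pol) → Pol
  ∑P = sumFromP F

  -- coefficient sequence of x * p, for a coefficient sequence c of p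
  shift : (ℕ → Carrier) → ℕ → Carrier
  shift c zero    = 0#
  shift c (suc n) = c n

  δ : ℕ → ℕ → Carrier
  δ k = cf (monomial F k 1#)

  cf-⊕ : ∀ p q n → cf (p ⊕ q) n ≈ cf p n + cf q n
  cf-⊕ []       q        n       = sym (+-identityˡ _)
  cf-⊕ (c ∷ cs) []       n       = sym (+-identityʳ _)
  cf-⊕ (c ∷ cs) (d ∷ ds) zero    = refl
  cf-⊕ (c ∷ cs) (d ∷ ds) (suc n) = cf-⊕ cs ds n

  cf-scale : ∀ a p n → cf (scaleP F a p) n ≈ a * cf p n
  cf-scale a []       n       = sym (zeroʳ a)
  cf-scale a (c ∷ cs) zero    = refl
  cf-scale a (c ∷ cs) (suc n) = cf-scale a cs n

  cf-∑ : ∀ a k g n → cf (∑P a k g) n ≈ ∑ a k (λ m → cf (g m) n)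
  cf-∑ a zero    g n = refl
  cf-∑ a (suc k) g n = trans (cf-⊕ (g a) _ n) (+-congˡ (cf-∑ (suc a) k g n))

  cf-monomial : ∀ k c n → cf (monomial F k c) n ≈ c * δ k n
  cf-monomial zero    c zero    = sym (*-identityʳ c)
  cf-monomial zero    c (suc n) = sym (zeroʳ c)
  cf-monomial (suc k) c zero    = sym (zeroʳ c)
  cf-monomial (suc k) c (suc n) = cf-monomial k c n

  cf-×lin : ∀ β p n → cf (×lin β p) n ≈ shift (cf p) n + - β * cf p n
  cf-×lin β p zero    = trans (cf-⊕ (0# ∷ p) (scaleP F (- β) p) 0) (+-congˡ (cf-scale (- β) p 0))
  cf-×lin β p (suc n) = trans (cf-⊕ (0# ∷ p) (scaleP F (- β) p) (suc n)) (+-congˡ (cf-scale (- β) p (suc n)))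

  shift-cong : ∀ {c d} → (∀ n → c n ≈ d n) → ∀ n → shift c n ≈ shift d n
  shift-cong c≈d zero    = refl
  shift-cong c≈d (suc n) = c≈d n

  shift-monomial : ∀ a k c n → shift (λ m → a * δ k m + c m) n ≈ a * δ (suc k) n + shift c n
  shift-monomial a k c zero    = solve 1 (λ a → con (+ 0) := a :* con (+ 0) :+ con (+ 0)) refl a
  shift-monomial a k c (suc n) = refl

  shift-∑ : ∀ a k (b : ℕ → Carrier) (c : ℕ → ℕ → Carrier) n → shift (λ m → ∑ a k (λ j → b j * c j m)) n ≈ ∑ a k (λ j → b j * shift (c j) n)
  shift-∑ a k b c zero    = sym (trans (∑-cong a k {λ j → b j * 0#} (λ j _ → zeroʳ (b j))) (∑-zero a k))
    where
    ∑-zero : ∀ a k → ∑ a k (λ _ → 0#) ≈ 0#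
    ∑-zero a zero    = refl
    ∑-zero a (suc k) = trans (+-identityˡ _) (∑-zero (suc a) k)
  shift-∑ a k b c (suc n) = refl

  ev-⊕ : ∀ p q x → ev (p ⊕ q) x ≈ ev p x + ev q x
  ev-⊕ []       q        x = sym (+-identityˡ _)
  ev-⊕ (c ∷ cs) []       x = sym (+-identityʳ _)
  ev-⊕ (c ∷ cs) (d ∷ ds) x = begin
    (c + d) + x * ev (cs ⊕ ds) x           ≈⟨ +-congˡ (*-congˡ (ev-⊕ cs ds x)) ⟩
    (c + d) + x * (ev cs x + ev ds x)      ≈⟨ solve 5 (λ c d x A B → (c :+ d) :+ x :* (A :+ B) := (c :+ x :* A) :+ (d :+ x :* B)) refl c d x _ _ ⟩
    (c + x * ev cs x) + (d + x * ev ds x)  ∎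

  ev-scale : ∀ a p x → ev (scaleP F a p) x ≈ a * ev p x
  ev-scale a []       x = sym (zeroʳ a)
  ev-scale a (c ∷ cs) x = begin
    a * c + x * ev (scaleP F a cs) x   ≈⟨ +-congˡ (*-congˡ (ev-scale a cs x)) ⟩
    a * c + x * (a * ev cs x)          ≈⟨ solve 4 (λ a c x A → a :* c :+ x :* (a :* A) := a :* (c :+ x :* A)) refl a c x _ ⟩
    a * (c + x * ev cs x)              ∎

  ev-monomial : ∀ k c x → ev (monomial F k c) x ≈ c * x ^ k
  ev-monomial zero    c x = trans (solve 2 (λ c x → c :+ x :* con (+ 0) := c) refl c x) (sym (*-identityʳ c))
  ev-monomial (suc k) c x = begin
    0# + x * ev (monomial F k c) x   ≈⟨ +-congˡ (*-congˡ (ev-monomial k c x)) ⟩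
    0# + x * (c * x ^ k)             ≈⟨ solve 3 (λ c x A → con (+ 0) :+ x :* (c :* A) := c :* (x :* A)) refl c x _ ⟩
    c * (x * x ^ k)                  ∎

  ev-∑ : ∀ a k g x → ev (∑P a k g) x ≈ ∑ a k (λ m → ev (g m) x)
  ev-∑ a zero    g x = refl
  ev-∑ a (suc k) g x = trans (ev-⊕ (g a) _ x) (+-congˡ (ev-∑ (suc a) k g x))

  ev-×lin : ∀ β p x → ev (×lin β p) x ≈ (x - β) * ev p x
  ev-×lin β p x = begin
    ev ((0# ∷ p) ⊕ scaleP F (- β) p) x        ≈⟨ ev-⊕ (0# ∷ p) (scaleP F (- β) p) x ⟩
    (0# + x * ev p x) + ev (scaleP F (- β) p) x ≈⟨ +-congˡ (ev-scale (- β) p x) ⟩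
    (0# + x * ev p x) + - β * ev p x           ≈⟨ solve 3 (λ β x A → (con (+ 0) :+ x :* A) :+ :- β :* A := (x :- β) :* A) refl β x _ ⟩
    (x - β) * ev p x                            ∎

  ev-cong : ∀ {p q} → p ≋ q → ∀ x → ev p x ≈ ev q x
  ev-cong {[]}     {[]}     p≋q x = refl
  ev-cong {[]}     {d ∷ ds} p≋q x = begin
    0#               ≈⟨ solve 1 (λ x → con (+ 0) := con (+ 0) :+ x :* con (+ 0)) refl x ⟩
    0# + x * 0#      ≈⟨ +-cong (p≋q 0) (*-congˡ (ev-cong {[]} {ds} (λ n → p≋q (suc n)) x)) ⟩
    d + x * ev ds x  ∎
  ev-cong {c ∷ cs} {[]}     p≋q x = begin
    c + x * ev cs x  ≈⟨ +-cong (p≋q 0) (*-congˡ (ev-cong {cs} {[]} (λ n → p≋q (suc n)) x)) ⟩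
    0# + x * 0#      ≈⟨ solve 1 (λ x → con (+ 0) :+ x :* con (+ 0) := con (+ 0)) refl x ⟩
    0#               ∎
  ev-cong {c ∷ cs} {d ∷ ds} p≋q x = +-cong (p≋q 0) (*-congˡ (ev-cong {cs} {ds} (λ n → p≋q (suc n)) x))

  ×lin-root : ∀ β k Q → ev (mulLinPow F β (suc k) Q) β ≈ 0#
  ×lin-root β k Q = trans (ev-×lin β (mulLinPow F β k Q) β)
    (solve 2 (λ β A → (β :- β) :* A := con (+ 0)) refl β _)

  cf-beyond : ∀ p n → length p ≤ n → cf p n ≈ 0#
  cf-beyond []       n       _           = refl
  cf-beyond (c ∷ cs) (suc n) (s≤s len≤n) = cf-beyond cs n len≤n

  backward-zero : ∀ β (D : ℕ → Carrier) N → (∀ n → D n ≈ β * D (suc n)) →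
                  (∀ n → N ≤ n → D n ≈ 0#) → ∀ n → D n ≈ 0#
  backward-zero β D N step tail n = go N n (ℕP.m≤m+n N n)
    where
    go : ∀ k n → N ≤ k ℕ.+ n → D n ≈ 0#
    go zero    n N≤n   = tail n N≤n
    go (suc k) n N≤k+n = begin
      D n            ≈⟨ step n ⟩
      β * D (suc n)  ≈⟨ *-congˡ (go k (suc n) (ℕP.≤-trans N≤k+n (ℕP.≤-reflexive (≡.sym (ℕP.+-suc k n))))) ⟩
      β * 0#         ≈⟨ zeroʳ β ⟩
      0#             ∎

  ×lin-cancel : ∀ β A B → ×lin β A ≋ ×lin β B → A ≋ B
  ×lin-cancel β A B eq n = begin
    cf A n                   ≈⟨ solve 2 (λ a b → a := (a :- b) :+ b) refl (cf A n) (cf B n) ⟩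
    D n + cf B n             ≈⟨ +-congʳ (backward-zero β D (length A ℕ.+ length B) D-step D-tail n) ⟩
    0# + cf B n              ≈⟨ +-identityˡ _ ⟩
    cf B n                   ∎
    where
    D : ℕ → Carrier
    D n = cf A n - cf B n
    D-step : ∀ n → D n ≈ β * D (suc n)
    D-step n = begin
      cf A n - cf B n
        ≈⟨ solve 5 (λ β a b a′ b′ → a :- b := (a :+ :- β :* a′) :- (b :+ :- β :* b′) :+ β :* (a′ :- b′)) refl β _ _ _ _ ⟩
      (cf A n + - β * cf A (suc n)) - (cf B n + - β * cf B (suc n)) + β * D (suc n)
        ≈⟨ +-congʳ (+-congʳ (trans (sym (cf-×lin β A (suc n))) (trans (eq (suc n)) (cf-×lin β B (suc n))))) ⟩
      (cf B n + - β * cf B (suc n)) - (cf B n + - β * cf B (suc n)) + β * D (suc n)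
        ≈⟨ solve 2 (λ y z → y :- y :+ z := z) refl _ _ ⟩
      β * D (suc n)   ∎
    D-tail : ∀ n → length A ℕ.+ length B ≤ n → D n ≈ 0#
    D-tail n len≤n = begin
      cf A n - cf B n  ≈⟨ +-cong (cf-beyond A n (ℕP.m+n≤o⇒m≤o _ len≤n)) (-‿cong (cf-beyond B n (ℕP.m+n≤o⇒n≤o _ len≤n))) ⟩
      0# - 0#          ≈⟨ solve 0 (con (+ 0) :- con (+ 0) := con (+ 0)) refl ⟩
      0#               ∎

  window : (ℕ → Carrier) → ℕ → ℕ → ℕ → Pol
  window r a e k = ∑P a k (λ m → monomial F (e ∸ m) (r m))

  cf-telescoped : ∀ β c d k W n →
    cf ((monomial F 0 c ⊕ monomial F k d) ⊕ ×lin β W) n ≈ (c * δ 0 n + d * δ k n) + (shift (cf W) n + - β * cf W n)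
  cf-telescoped β c d k W n = begin
    cf ((monomial F 0 c ⊕ monomial F k d) ⊕ ×lin β W) n
      ≈⟨ cf-⊕ (monomial F 0 c ⊕ monomial F k d) (×lin β W) n ⟩
    cf (monomial F 0 c ⊕ monomial F k d) n + cf (×lin β W) n
      ≈⟨ +-cong (trans (cf-⊕ (monomial F 0 c) (monomial F k d) n) (+-cong (cf-monomial 0 c n) (cf-monomial k d n))) (cf-×lin β W n) ⟩
    (c * δ 0 n + d * δ k n) + (shift (cf W) n + - β * cf W n) ∎

  module Telescope (β : Carrier) (r s : ℕ → Carrier) (r≈Δs : ∀ m → r m ≈ s (suc m) - β * s m) where

    telescope : ∀ k a e → e ≡ a ℕ.+ k →
      window r a e (suc k) ≋ (monomial F 0 (s (suc e)) ⊕ monomial F k (- β * s a)) ⊕ ×lin β (window s (suc a) e k)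
    telescope zero a e ≡.refl n = begin
      cf (window r a e 1) n                    ≈⟨ trans (cf-⊕ (monomial F (e ∸ a) (r a)) [] n) (+-identityʳ _) ⟩
      cf (monomial F (e ∸ a) (r a)) n          ≡⟨ ≡.cong (λ i → cf (monomial F i (r a)) n) (ℕP.m+n∸m≡n a 0) ⟩
      cf (monomial F 0 (r a)) n                ≈⟨ trans (cf-monomial 0 (r a) n) (*-congʳ (r≈Δs a)) ⟩
      (s (suc a) - β * s a) * δ 0 n            ≈⟨ solve 4 (λ β s s′ d → (s′ :- β :* s) :* d := (s′ :* d :+ :- β :* s :* d) :+ (con (+ 0) :+ :- β :* con (+ 0))) refl β _ _ _ ⟩
      (s (suc a) * δ 0 n + - β * s a * δ 0 n) + (0# + - β * 0#)
        ≡⟨ ≡.cong₂ (λ i Z → (s (suc i) * δ 0 n + - β * s a * δ 0 n) + (Z + - β * 0#)) (ℕP.+-identityʳ a) (shift-[] n) ⟨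
      (s (suc e) * δ 0 n + - β * s a * δ 0 n) + (shift (cf []) n + - β * cf [] n)
        ≈⟨ cf-telescoped β (s (suc e)) (- β * s a) 0 [] n ⟨
      cf ((monomial F 0 (s (suc e)) ⊕ monomial F 0 (- β * s a)) ⊕ ×lin β []) n ∎
      where
      shift-[] : ∀ n → shift (cf []) n ≡ 0#
      shift-[] zero    = ≡.refl
      shift-[] (suc n) = ≡.refl
    telescope (suc k) a e ≡.refl n = begin
      cf (window r a e (suc (suc k))) n
        ≈⟨ cf-⊕ (monomial F (e ∸ a) (r a)) (window r (suc a) e (suc k)) n ⟩
      cf (monomial F (e ∸ a) (r a)) n + cf (window r (suc a) e (suc k)) n
        ≈⟨ +-cong (trans (cf-monomial (e ∸ a) (r a) n) (*-cong (r≈Δs a) (≈-δ e∸a≡1+k)))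
                  (trans (telescope k (suc a) e (ℕP.+-suc a k) n) (cf-telescoped β (s (suc e)) (- β * s (suc a)) k W′ n)) ⟩
      (s (suc a) - β * s a) * δ (suc k) n
        + ((s (suc e) * δ 0 n + - β * s (suc a) * δ k n) + (shift (cf W′) n + - β * cf W′ n))
        ≈⟨ solve 9 (λ β s s′ se d0 dk dk′ w sw →
             (s′ :- β :* s) :* dk′ :+ ((se :* d0 :+ :- β :* s′ :* dk) :+ (sw :+ :- β :* w))
             := (se :* d0 :+ :- β :* s :* dk′) :+ ((s′ :* dk′ :+ sw) :+ :- β :* (s′ :* dk :+ w)))
           refl β (s a) (s (suc a)) (s (suc e)) (δ 0 n) (δ k n) (δ (suc k) n) (cf W′ n) (shift (cf W′) n) ⟩
      (s (suc e) * δ 0 n + - β * s a * δ (suc k) n)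
        + ((s (suc a) * δ (suc k) n + shift (cf W′) n) + - β * (s (suc a) * δ k n + cf W′ n))
        ≈⟨ +-congˡ (+-cong (trans (shift-cong W-split n) (shift-monomial (s (suc a)) k (cf W′) n)) (*-congˡ (W-split n))) ⟨
      (s (suc e) * δ 0 n + - β * s a * δ (suc k) n) + (shift (cf W) n + - β * cf W n)
        ≈⟨ cf-telescoped β (s (suc e)) (- β * s a) (suc k) W n ⟨
      cf ((monomial F 0 (s (suc e)) ⊕ monomial F (suc k) (- β * s a)) ⊕ ×lin β W) n ∎
      where
      W W′ : Pol
      W  = window s (suc a) e (suc k)
      W′ = window s (suc (suc a)) e k
      e∸a≡1+k : e ∸ a ≡ suc k
      e∸a≡1+k = ℕP.m+n∸m≡n a (suc k)
      ≈-δ : ∀ {i j} → i ≡ j → δ i n ≈ δ j n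
      ≈-δ ≡.refl = refl
      W-split : ∀ m → cf W m ≈ s (suc a) * δ k m + cf W′ m
      W-split m = trans (cf-⊕ (monomial F (e ∸ suc a) (s (suc a))) W′ m)
        (+-congʳ (trans (cf-monomial (e ∸ suc a) (s (suc a)) m)
                        (*-congˡ (reflexive (≡.cong (λ i → δ i m) (≡.trans (≡.cong (_∸ suc a) (ℕP.+-suc a k)) (ℕP.m+n∸m≡n (suc a) k)))))))

  -- Number of terms of the inner sum ∑_{m=L}^{L+d} of P.
  1+m+n∸m≡1+n : ∀ m n → suc (m ℕ.+ n) ∸ m ≡ suc n
  1+m+n∸m≡1+n m n = ≡.trans (≡.cong (_∸ m) (≡.sym (ℕP.+-suc m n))) (ℕP.m+n∸m≡n m (suc n))

  module Recurrence (t : ℕ) (b : ℕ → Carrier) (β : Carrier) where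

    P : ℕ → Stream F → Pol
    P = Ppoly F t b

    inner : ℕ → ℕ → Stream F → Pol
    inner L j r = sumRangeP F L (j ∸ 1) (λ m → monomial F (j ∸ 1 ∸ m) (r (+ m)))

    cf-P : ∀ L r n → cf (P L r) n ≈ ∑ (suc L) (t ∸ L) (λ j → b j * cf (inner L j r) n)
    cf-P L r n = trans (cf-∑ (suc L) (t ∸ L) (λ j → scaleP F (b j) (inner L j r)) n)
                       (∑-cong (suc L) (t ∸ L) (λ j _ → cf-scale (b j) (inner L j r) n))

    ev-P : ∀ L r x → ev (P L r) x ≈ ∑ (suc L) (t ∸ L) (λ j → b j * ev (inner L j r) x)
    ev-P L r x = trans (ev-∑ (suc L) (t ∸ L) (λ j → scaleP F (b j) (inner L j r)) x)
                       (∑-cong (suc L) (t ∸ L) (λ j _ → ev-scale (b j) (inner L j r) x))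

    Lifts : Stream F → Stream F → Set
    Lifts s r = ∀ n → shiftMinus F β s n ≈ r n

    lifts-at : ∀ {s r} → Lifts s r → ∀ m → r (+ m) ≈ s (+ suc m) - β * s (+ m)
    lifts-at {s} s↦r m = trans (sym (s↦r (+ m))) (+-congʳ (reflexive (≡.cong (λ i → s (+ i)) (ℕP.+-comm m 1))))

    inner-telescope : ∀ {s r} → Lifts s r → ∀ L j → suc L ≤ j →
      inner L j r ≋ (monomial F 0 (s (+ j)) ⊕ monomial F (j ∸ suc L) (- β * s (+ L))) ⊕ ×lin β (inner (suc L) j s)
    inner-telescope {s} {r} s↦r L j L<j with ℕP.m≤n⇒∃[o]m+o≡n L<j
    ... | d , ≡.refl = λ n → begin
      cf (inner L j r) n
        ≡⟨ ≡.cong (λ k → cf (∑P L k (λ m → monomial F (L ℕ.+ d ∸ m) (r (+ m)))) n) (1+m+n∸m≡1+n L d) ⟩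
      cf (window (λ m → r (+ m)) L (L ℕ.+ d) (suc d)) n
        ≈⟨ Telescope.telescope β (λ m → r (+ m)) (λ m → s (+ m)) (lifts-at s↦r) d L (L ℕ.+ d) ≡.refl n ⟩
      cf ((monomial F 0 (s (+ j)) ⊕ monomial F d (- β * s (+ L))) ⊕ ×lin β (window (λ m → s (+ m)) (suc L) (L ℕ.+ d) d)) n
        ≡⟨ ≡.cong₂ (λ k l → cf ((monomial F 0 (s (+ j)) ⊕ monomial F k (- β * s (+ L))) ⊕ ×lin β (∑P (suc L) l (λ m → monomial F (L ℕ.+ d ∸ m) (s (+ m))))) n)
                   (ℕP.m+n∸m≡n L d) (ℕP.m+n∸m≡n L d) ⟨
      cf ((monomial F 0 (s (+ j)) ⊕ monomial F (j ∸ suc L) (- β * s (+ L))) ⊕ ×lin β (inner (suc L) j s)) n ∎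

    recurrence-tail : ∀ {s} L → InG F t b s → (∀ m → m ≤ L → s (+ m) ≈ 0#) →
                      ∑ (suc L) (t ∸ L) (λ j → b j * s (+ j)) ≈ 0#
    recurrence-tail L s∈G zeros =
      trans (sym (∑-tail t L _ (λ m m≤L → trans (*-congˡ (zeros m m≤L)) (zeroʳ _)))) (s∈G (+ 0))

    -- The inner polynomials of P (L+1) s, summed from j = L+1 (where the inner sum is empty).
    cf-P-next : ∀ L s m → ∑ (suc L) (t ∸ L) (λ j → b j * cf (inner (suc L) j s) m) ≈ cf (P (suc L) s) m
    cf-P-next L s m = begin
      ∑ (suc L) (t ∸ L) g                    ≈⟨ ∑-drop-first (suc L) (t ∸ L) g empty ⟩
      ∑ (suc (suc L)) (ℕ.pred (t ∸ L)) g     ≡⟨ ≡.cong (λ k → ∑ (suc (suc L)) k g) (ℕP.pred[m∸n]≡m∸[1+n] t L) ⟩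
      ∑ (suc (suc L)) (t ∸ suc L) g          ≈⟨ cf-P (suc L) s m ⟨
      cf (P (suc L) s) m                     ∎
      where
      g : ℕ → Carrier
      g j = b j * cf (inner (suc L) j s) m
      empty : g (suc L) ≈ 0#
      empty = trans (*-congˡ (reflexive (≡.cong (λ k → cf (∑P (suc L) k (λ i → monomial F (L ∸ i) (s (+ i)))) m) (ℕP.n∸n≡0 L))))
                    (zeroʳ _)

    factor : ∀ {s r} L → Lifts s r → InG F t b s → (∀ m → m ≤ L → s (+ m) ≈ 0#) → P L r ≋ ×lin β (P (suc L) s)
    factor {s} {r} L s↦r s∈G zeros n = begin
      cf (P L r) n
        ≈⟨ trans (cf-P L r n) (∑-cong (suc L) (t ∸ L) term) ⟩
      ∑ (suc L) (t ∸ L) (λ j → δ 0 n * (b j * s (+ j)) + (b j * shift (c j) n + - β * (b j * c j n)))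
        ≈⟨ trans (∑-+ (suc L) (t ∸ L) _ _) (+-cong (∑-scale (suc L) (t ∸ L) (δ 0 n) _)
                 (trans (∑-+ (suc L) (t ∸ L) _ _) (+-congˡ (∑-scale (suc L) (t ∸ L) (- β) _)))) ⟩
      δ 0 n * ∑ (suc L) (t ∸ L) (λ j → b j * s (+ j))
        + (∑ (suc L) (t ∸ L) (λ j → b j * shift (c j) n) + - β * ∑ (suc L) (t ∸ L) (λ j → b j * c j n))
        ≈⟨ +-cong (trans (*-congˡ (recurrence-tail {s} L s∈G zeros)) (zeroʳ _))
                  (+-cong (sym (shift-∑ (suc L) (t ∸ L) b c n)) (*-congˡ (cf-P-next L s n))) ⟩
      0# + (shift (λ m → ∑ (suc L) (t ∸ L) (λ j → b j * c j m)) n + - β * cf (P (suc L) s) n)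
        ≈⟨ trans (+-identityˡ _) (+-congʳ (shift-cong (cf-P-next L s) n)) ⟩
      shift (cf (P (suc L) s)) n + - β * cf (P (suc L) s) n
        ≈⟨ cf-×lin β (P (suc L) s) n ⟨
      cf (×lin β (P (suc L) s)) n ∎
      where
      c : ℕ → ℕ → Carrier
      c j = cf (inner (suc L) j s)
      term : ∀ j → suc L ≤ j → b j * cf (inner L j r) n ≈ δ 0 n * (b j * s (+ j)) + (b j * shift (c j) n + - β * (b j * c j n))
      term j L<j = begin
        b j * cf (inner L j r) n
          ≈⟨ *-congˡ (trans (inner-telescope s↦r L j L<j n) (cf-telescoped β (s (+ j)) (- β * s (+ L)) (j ∸ suc L) (inner (suc L) j s) n)) ⟩
        b j * ((s (+ j) * δ 0 n + - β * s (+ L) * δ (j ∸ suc L) n) + (shift (c j) n + - β * c j n))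
          ≈⟨ *-congˡ (+-congʳ (+-congˡ (*-congʳ (*-congˡ (zeros L ℕP.≤-refl))))) ⟩
        b j * ((s (+ j) * δ 0 n + - β * 0# * δ (j ∸ suc L) n) + (shift (c j) n + - β * c j n))
          ≈⟨ solve 7 (λ β bj sj d0 d w sw → bj :* ((sj :* d0 :+ :- β :* con (+ 0) :* d) :+ (sw :+ :- β :* w))
                                              := d0 :* (bj :* sj) :+ (bj :* sw :+ :- β :* (bj :* w)))
                refl β (b j) (s (+ j)) (δ 0 n) (δ (j ∸ suc L) n) (c j n) (shift (c j) n) ⟩
        δ 0 n * (b j * s (+ j)) + (b j * shift (c j) n + - β * (b j * c j n)) ∎

    geometric : ∀ {s r} L → Lifts s r → (∀ m → m < L → r (+ m) ≈ 0#) → ∀ m → m ≤ L → s (+ m) ≈ β ^ m * s (+ 0)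
    geometric L s↦r zeros zero    _   = sym (*-identityˡ _)
    geometric {s} L s↦r zeros (suc m) m<L = begin
      s (+ suc m)                                 ≈⟨ solve 3 (λ x y z → x := (x :- y :* z) :+ y :* z) refl _ β _ ⟩
      (s (+ suc m) - β * s (+ m)) + β * s (+ m)   ≈⟨ +-cong (trans (sym (lifts-at s↦r m)) (zeros m m<L))
                                                             (*-congˡ (geometric L s↦r zeros m (ℕP.<⇒≤ m<L))) ⟩
      0# + β * (β ^ m * s (+ 0))                  ≈⟨ solve 3 (λ β p x → con (+ 0) :+ β :* (p :* x) := (β :* p) :* x) refl β _ _ ⟩
      (β * β ^ m) * s (+ 0)                       ∎

    ^-split : ∀ L j → suc L ≤ j → β ^ j ≈ β * (β ^ L * β ^ (j ∸ suc L))
    ^-split L j L<j = begin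
      β ^ j                               ≡⟨ ≡.cong (β ^_) (ℕP.m+[n∸m]≡n L<j) ⟨
      β * β ^ (L ℕ.+ (j ∸ suc L))          ≈⟨ *-congˡ (^-+ β L (j ∸ suc L)) ⟩
      β * (β ^ L * β ^ (j ∸ suc L))        ∎

    ev-inner : ∀ {s r} L → Lifts s r → (∀ m → m < L → r (+ m) ≈ 0#) →
               ∀ j → suc L ≤ j → ev (inner L j r) β ≈ s (+ j) - β ^ j * s (+ 0)
    ev-inner {s} {r} L s↦r zeros j L<j = begin
      ev (inner L j r) β
        ≈⟨ ev-cong {inner L j r} {(monomial F 0 (s (+ j)) ⊕ monomial F e (- β * s (+ L))) ⊕ ×lin β I} (inner-telescope s↦r L j L<j) β ⟩
      ev ((monomial F 0 (s (+ j)) ⊕ monomial F e (- β * s (+ L))) ⊕ ×lin β I) β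
        ≈⟨ trans (ev-⊕ (monomial F 0 (s (+ j)) ⊕ monomial F e (- β * s (+ L))) (×lin β I) β)
                 (+-cong (trans (ev-⊕ (monomial F 0 (s (+ j))) (monomial F e (- β * s (+ L))) β)
                                (+-cong (trans (ev-monomial 0 (s (+ j)) β) (*-identityʳ _)) (ev-monomial e _ β)))
                         (ev-×lin β I β)) ⟩
      (s (+ j) + - β * s (+ L) * β ^ e) + (β - β) * ev I β
        ≈⟨ +-congʳ (+-congˡ (*-congʳ (*-congˡ (geometric L s↦r zeros L ℕP.≤-refl)))) ⟩
      (s (+ j) + - β * (β ^ L * s (+ 0)) * β ^ e) + (β - β) * ev I β
        ≈⟨ solve 6 (λ β sj pL s0 pe v → (sj :+ :- β :* (pL :* s0) :* pe) :+ (β :- β) :* v := sj :- β :* (pL :* pe) :* s0)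
             refl β (s (+ j)) (β ^ L) (s (+ 0)) (β ^ e) (ev I β) ⟩
      s (+ j) - β * (β ^ L * β ^ e) * s (+ 0)
        ≈⟨ +-congˡ (-‿cong (*-congʳ (^-split L j L<j))) ⟨
      s (+ j) - β ^ j * s (+ 0) ∎
      where
      e : ℕ
      e = j ∸ suc L
      I : Pol
      I = inner (suc L) j s

    ev-P-at-β : ∀ {s r} L → Lifts s r → InG F t b s → (∀ m → m < L → r (+ m) ≈ 0#) →
                ev (P L r) β ≈ - (evalCoeffs F t b β * s (+ 0))
    ev-P-at-β {s} {r} L s↦r s∈G zeros = begin
      ev (P L r) β
        ≈⟨ trans (ev-P L r β) (∑-cong (suc L) (t ∸ L) term) ⟩
      ∑ (suc L) (t ∸ L) h
        ≈⟨ ∑-tail t L h h-vanishes ⟨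
      ∑ 0 (suc t) h
        ≈⟨ trans (∑-+ 0 (suc t) _ _) (+-cong (s∈G (+ 0)) (∑-scale 0 (suc t) (- s (+ 0)) _)) ⟩
      0# + - s (+ 0) * evalCoeffs F t b β
        ≈⟨ solve 2 (λ x f → con (+ 0) :+ :- x :* f := :- (f :* x)) refl (s (+ 0)) _ ⟩
      - (evalCoeffs F t b β * s (+ 0)) ∎
      where
      h : ℕ → Carrier
      h j = b j * s (+ j) + - s (+ 0) * (b j * β ^ j)
      term : ∀ j → suc L ≤ j → b j * ev (inner L j r) β ≈ h j
      term j L<j = trans (*-congˡ (ev-inner L s↦r zeros j L<j))
        (solve 4 (λ bj sj p s0 → bj :* (sj :- p :* s0) := bj :* sj :+ :- s0 :* (bj :* p)) refl (b j) (s (+ j)) (β ^ j) (s (+ 0)))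
      h-vanishes : ∀ m → m ≤ L → h m ≈ 0#
      h-vanishes m m≤L = trans (+-congʳ (*-congˡ (geometric L s↦r zeros m m≤L)))
        (solve 3 (λ bm p s0 → bm :* (p :* s0) :+ :- s0 :* (bm :* p) := con (+ 0)) refl (b m) (β ^ m) (s (+ 0)))

    lift-vanishes : ∀ {s r} L → Lifts s r → (∀ m → m < L → r (+ m) ≈ 0#) → s (+ 0) ≈ 0# → ∀ m → m ≤ L → s (+ m) ≈ 0#
    lift-vanishes L s↦r zeros s₀≈0 m m≤L = trans (geometric L s↦r zeros m m≤L) (trans (*-congˡ s₀≈0) (zeroʳ _))

    run-extends : ∀ {s r} L → Lifts s r → RunOfZeroesAt0 F r L → s (+ 0) ≈ 0# → RunOfZeroesAt0 F s (suc L)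
    run-extends {s} {r} L s↦r (r₋₁≉0 , zeros , r-L≉0) s₀≈0 = s₋₁≉0 , s-zeros , s-L+1≉0
      where
      s-zeros : ∀ m → m < suc L → s (+ m) ≈ 0#
      s-zeros m m<1+L = lift-vanishes L s↦r zeros s₀≈0 m (ℕP.≤-pred m<1+L)
      difference-vanishes : ∀ {x y} → x ≈ 0# → y ≈ 0# → x - β * y ≈ 0#
      difference-vanishes x≈0 y≈0 = trans (+-cong x≈0 (-‿cong (*-congˡ y≈0)))
        (solve 1 (λ β → con (+ 0) :- β :* con (+ 0) := con (+ 0)) refl β)
      s₋₁≉0 : ¬ (s -[1+ 0 ] ≈ 0#)
      s₋₁≉0 s₋₁≈0 = r₋₁≉0 (trans (sym (s↦r -[1+ 0 ])) (difference-vanishes s₀≈0 s₋₁≈0))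
      s-L+1≉0 : ¬ (s (+ suc L) ≈ 0#)
      s-L+1≉0 s-L+1≈0 = r-L≉0 (trans (lifts-at s↦r L) (difference-vanishes s-L+1≈0 (s-zeros L ℕP.≤-refl)))

    lift-starts-at-zero : ∀ {s r} L → Lifts s r → InG F t b s → (∀ m → m < L → r (+ m) ≈ 0#) →
                          ¬ (evalCoeffs F t b β ≈ 0#) → ev (P L r) β ≈ 0# → s (+ 0) ≈ 0#
    lift-starts-at-zero {s} {r} L s↦r s∈G zeros fβ≉0 Pβ≈0 = nonzero-cancel fβ≉0 (begin
      evalCoeffs F t b β * s (+ 0)         ≈⟨ -‿involutive _ ⟨
      - - (evalCoeffs F t b β * s (+ 0))   ≈⟨ -‿cong (ev-P-at-β L s↦r s∈G zeros) ⟨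
      - ev (P L r) β                       ≈⟨ trans (-‿cong Pβ≈0) -0#≈0# ⟩
      0#                                   ∎)

    descend : ∀ {s r} L k Q → Lifts s r → InG F t b s → ¬ (evalCoeffs F t b β ≈ 0#) →
              RunOfZeroesAt0 F r L → P L r ≋ mulLinPow F β (suc k) Q →
              RunOfZeroesAt0 F s (suc L) × P (suc L) s ≋ mulLinPow F β k Q
    descend {s} {r} L k Q s↦r s∈G fβ≉0 run P≋ = run-extends L s↦r run s₀≈0 , ×lin-cancel β (P (suc L) s) (mulLinPow F β k Q) factored
      where
      s₀≈0 : s (+ 0) ≈ 0#
      s₀≈0 = lift-starts-at-zero L s↦r s∈G (proj₁ (proj₂ run)) fβ≉0
               (trans (ev-cong {P L r} {mulLinPow F β (suc k) Q} P≋ β) (×lin-root β k Q))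
      factored : ×lin β (P (suc L) s) ≋ ×lin β (mulLinPow F β k Q)
      factored n = trans (sym (factor L s↦r s∈G (lift-vanishes L s↦r (proj₁ (proj₂ run)) s₀≈0) n)) (P≋ n)

    descent-ends : ∀ {s r} L Q → Lifts s r → InG F t b s → RunOfZeroesAt0 F r L → P L r ≋ Q → ¬ (ev Q β ≈ 0#) → ¬ (s (+ 0) ≈ 0#)
    descent-ends {s} {r} L Q s↦r s∈G run P≋Q Qβ≉0 s₀≈0 = Qβ≉0 (begin
      ev Q β                                ≈⟨ ev-cong {P L r} {Q} P≋Q β ⟨
      ev (P L r) β                          ≈⟨ ev-P-at-β L s↦r s∈G (proj₁ (proj₂ run)) ⟩
      - (evalCoeffs F t b β * s (+ 0))      ≈⟨ -‿cong (*-congˡ s₀≈0) ⟩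
      - (evalCoeffs F t b β * 0#)           ≈⟨ solve 1 (λ f → :- (f :* con (+ 0)) := con (+ 0)) refl _ ⟩
      0#                                    ∎)

    descent : (r : ℕ → Stream F) → (∀ i → InG F t b (r (suc i)) × Lifts (r (suc i)) (r i)) →
              ¬ (evalCoeffs F t b β ≈ 0#) → ∀ l z Q → RunOfZeroesAt0 F (r 0) l → P l (r 0) ≋ mulLinPow F β z Q →
              ∀ i k → i ℕ.+ k ≡ z → RunOfZeroesAt0 F (r i) (l ℕ.+ i) × P (l ℕ.+ i) (r i) ≋ mulLinPow F β k Q
    descent r lifts fβ≉0 l z Q run₀ P≋ zero k ≡.refl rewrite ℕP.+-identityʳ l = run₀ , P≋
    descent r lifts fβ≉0 l z Q run₀ P≋ (suc i) k i+k≡z rewrite ℕP.+-suc l i =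
      descend (l ℕ.+ i) k Q (proj₂ (lifts i)) (proj₁ (lifts i)) fβ≉0 run P≋ᵢ
      where
      previous : RunOfZeroesAt0 F (r i) (l ℕ.+ i) × P (l ℕ.+ i) (r i) ≋ mulLinPow F β (suc k) Q
      previous = descent r lifts fβ≉0 l z Q run₀ P≋ i (suc k) (≡.trans (ℕP.+-suc i k) i+k≡z)
      run : RunOfZeroesAt0 F (r i) (l ℕ.+ i)
      run = proj₁ previous
      P≋ᵢ : P (l ℕ.+ i) (r i) ≋ mulLinPow F β (suc k) Q
      P≋ᵢ = proj₂ previous

open import Data.Nat using (ℕ; suc; _+_; _≤_)
open import Data.Integer using (+_)
open import Data.Product using (_×_)
open import Relation.Nullary using (¬_)

lemma6 : (F : FiniteField) →
    (t : ℕ) (b : ℕ → El F) → IsOne F (b t) → ¬ IsZero F (b 0) →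
    (β : El F) → ¬ IsZero F (evalCoeffs F t b β) →
    (r : ℕ → Stream F) → InG F t b (r 0) →
    (l : ℕ) → RunOfZeroesAt0 F (r 0) l →
    (∀ i → InG F t b (r (suc i)) × (∀ n → EqF F (shiftMinus F β (r (suc i)) n) (r i n))) →
    (z : ℕ) → Multiplicity F β (Ppoly F t b l (r 0)) z →
    (∀ i → i ≤ z → RunOfZeroesAt0 F (r i) (l + i)) × ¬ IsZero F (r (suc z) (+ 0))
lemma6 F t b _ _ β fβ≉0 r _ l run₀ lifts z (Q , P≋ , Qβ≉0) = runs , first-nonzero
  where
  open RunsOfZeroes F using (module Recurrence; _≋_)
  open Recurrence t b β using (P; descent; descent-ends)

  chain : ∀ i k → i + k ≡ z → RunOfZeroesAt0 F (r i) (l + i) × P (l + i) (r i) ≋ mulLinPow F β k Q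
  chain = descent r lifts fβ≉0 l z Q run₀ P≋

  runs : ∀ i → i ≤ z → RunOfZeroesAt0 F (r i) (l + i)
  runs i i≤z with ℕP.m≤n⇒∃[o]m+o≡n i≤z
  ... | k , i+k≡z = proj₁ (chain i k i+k≡z)

  first-nonzero : ¬ IsZero F (r (suc z) (+ 0))
  first-nonzero = descent-ends (l + z) Q (proj₂ (lifts z)) (proj₁ (lifts z)) (proj₁ at-z) (proj₂ at-z) Qβ≉0
    where
    at-z : RunOfZeroesAt0 F (r z) (l + z) × P (l + z) (r z) ≋ mulLinPow F β 0 Q
    at-z = chain z 0 (ℕP.+-identityʳ z)
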